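{- Let $S$ be a non special numerical semigroup, $h=\max(\operatorname{SG}(S)\setminus\{\operatorname{F}(S)\})$ and $T=\mathcal{A}(S)$. Then $2\operatorname{m}(S)$ and $h$ are minimal generators of $T$.
   Context: $\mathbb{N}=\{0,1,2,\ldots\}$. A numerical semigroup is a submonoid $S$ of $(\mathbb{N},+)$ with $\mathbb{N}\setminus S$ finite; an element $s\in S\setminus\{0\}$ is a minimal generator if it is not a sum of two elements of $S\setminus\{0\}$. $\operatorname{H}(S)=\mathbb{N}\setminus S$; $\operatorname{F}(S)=\max\operatorname{H}(S)$; $\operatorname{m}(S)=\min(S\setminus\{0\})$. Special gaps: $\operatorname{SG}(S)=\{h\in\operatorname{H}(S)\mid 2h\in S \text{ and } h+s\in S \text{ for all } s\in S\setminus\{0\}\}$. $S$ is special if there is no $h\in\operatorname{SG}(S)\setminus\{\operatorname{F}(S)\}$ with $h>\operatorname{m}(S)$. For non special $S$, $\mathcal{A}(S)=(S\cup\{h\})\setminus\{\operatorname{m}(S)\}$ with $h=\max(\operatorname{SG}(S)\setminus\{\operatorname{F}(S)\})$. -}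

module Defs where

open import Data.Nat using (ℕ; zero; suc; _+_; _*_; _≤_; _<_)
open import Data.Product using (Σ; ∃; _×_; _,_)
open import Data.Sum using (_⊎_)
open import Relation.Nullary using (¬_; Dec)
open import Relation.Binary.PropositionalEquality using (_≡_; _≢_)

-- A numerical semigroup: a submonoid of (ℕ,+) with finite complement.
-- Membership is given as a decidable predicate (harmless: every
-- numerical semigroup is decidable since it is cofinite).
record NumericalSemigroup : Set₁ where
  field
    _∈S   : ℕ → Set
    ∈S-dec : (n : ℕ) → Dec (n ∈S)
    zero∈ : 0 ∈S
    +-closed : ∀ {a b} → a ∈S → b ∈S → (a + b) ∈S
    cofinite : ∃ λ N → ∀ n → N ≤ n → n ∈S

open NumericalSemigroup public

IsGap : NumericalSemigroup → ℕ → Set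
IsGap S h = ¬ (_∈S S h)

IsFrobenius : NumericalSemigroup → ℕ → Set
IsFrobenius S f = IsGap S f × (∀ g → IsGap S g → g ≤ f)

IsMultiplicity : NumericalSemigroup → ℕ → Set
IsMultiplicity S m = _∈S S m × m ≢ 0 × (∀ s → _∈S S s → s ≢ 0 → m ≤ s)

IsSpecialGap : NumericalSemigroup → ℕ → Set
IsSpecialGap S h =
  IsGap S h × _∈S S (2 * h) × (∀ s → _∈S S s → s ≢ 0 → _∈S S (h + s))

Special : NumericalSemigroup → (m f : ℕ) → Set
Special S m f = ¬ (∃ λ h → IsSpecialGap S h × h ≢ f × m < h)

IsMaxSGminusF : NumericalSemigroup → (f h : ℕ) → Set
IsMaxSGminusF S f h =
  (IsSpecialGap S h × h ≢ f) × (∀ g → IsSpecialGap S g → g ≢ f → g ≤ h)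

_∈A[_,_,_] : ℕ → NumericalSemigroup → (h m : ℕ) → Set
n ∈A[ S , h , m ] = (_∈S S n ⊎ n ≡ h) × n ≢ m

IsMinimalGenerator : (ℕ → Set) → ℕ → Set
IsMinimalGenerator T s =
  T s × s ≢ 0 ×
  ¬ (∃ λ a → ∃ λ b → T a × a ≢ 0 × T b × b ≢ 0 × a + b ≡ s)

{-# OPTIONS --safe #-}
module Submission where

-- Every nonzero element of T = A(S) exceeds m(S), since m was removed and h > m(S) by
-- non-speciality; so 2m(S) cannot split into two of them. A splitting h = a + b would have
-- both summands below h, hence in S, forcing the gap h into S.

open import Defs
open import Data.Nat using (ℕ; _*_; _+_; _<_; z≤n; _<?_)
open import Data.Nat.Properties
  using (+-identityʳ; <-≤-trans; ≤-<-trans; <-irrefl; +-mono-<; +-comm; m<m+n; n≢0⇒n>0; >⇒≢; ≤∧≢⇒<)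
open import Data.Product using (∃; _×_; _,_; proj₁)
open import Data.Sum using (inj₁; inj₂)
open import Relation.Nullary using (¬_; yes; no; contradiction)
open import Relation.Binary.PropositionalEquality using (_≡_; _≢_; refl; sym; trans; cong; subst; ≢-sym)

SumOfTwoNonzero : (ℕ → Set) → ℕ → Set
SumOfTwoNonzero T s = ∃ λ a → ∃ λ b → T a × a ≢ 0 × T b × b ≢ 0 × a + b ≡ s

summand<sum : ∀ {a b s} → b ≢ 0 → a + b ≡ s → a < s
summand<sum {a} b≢0 refl = m<m+n a (n≢0⇒n>0 b≢0)

n+n≡2*n : ∀ n → n + n ≡ 2 * n
n+n≡2*n n = cong (n +_) (sym (+-identityʳ n))

double-not-SumOfTwoNonzero : ∀ {T : ℕ → Set} {m} →
  (∀ a → T a → a ≢ 0 → m < a) → ¬ SumOfTwoNonzero T (2 * m)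
double-not-SumOfTwoNonzero {m = m} above (a , b , aT , a≢0 , bT , b≢0 , a+b≡2m) =
  <-irrefl (sym a+b≡2m)
    (subst (_< a + b) (n+n≡2*n m) (+-mono-< (above a aT a≢0) (above b bT b≢0)))

gap-not-SumOfTwoNonzero : ∀ (S : NumericalSemigroup) {T : ℕ → Set} {g} →
  (∀ n → T n → n < g → _∈S S n) → IsGap S g → ¬ SumOfTwoNonzero T g
gap-not-SumOfTwoNonzero S below gap (a , b , aT , a≢0 , bT , b≢0 , a+b≡g) =
  gap (subst (_∈S S) a+b≡g (+-closed S
    (below a aT (summand<sum b≢0 a+b≡g))
    (below b bT (summand<sum a≢0 (trans (+-comm b a) a+b≡g)))))

multiplicity<maxSGminusF : ∀ {S m f h} →
  ¬ Special S m f → IsMaxSGminusF S f h → m < h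
multiplicity<maxSGminusF {m = m} {h = h} nonSpecial (_ , maximal) with m <? h
... | yes m<h = m<h
... | no m≮h = contradiction
  (λ { (g , gSG , g≢f , m<g) → m≮h (<-≤-trans m<g (maximal g gSG g≢f)) }) nonSpecial

module _ (S : NumericalSemigroup) {m h : ℕ} where

  ∈A⇒multiplicity< : IsMultiplicity S m → m < h →
    ∀ n → n ∈A[ S , h , m ] → n ≢ 0 → m < n
  ∈A⇒multiplicity< (_ , _ , minimal) _   n (inj₁ n∈S , n≢m) n≢0 =
    ≤∧≢⇒< (minimal n n∈S n≢0) (≢-sym n≢m)
  ∈A⇒multiplicity< _                  m<h n (inj₂ refl , _) _ = m<h

  ∈A∧<⇒∈S : ∀ n → n ∈A[ S , h , m ] → n < h → _∈S S n
  ∈A∧<⇒∈S n (inj₁ n∈S , _) _ = n∈S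
  ∈A∧<⇒∈S n (inj₂ refl , _) n<h = contradiction n<h (<-irrefl refl)

proposition4p7 : (S : NumericalSemigroup) (m f h : ℕ) →
    IsMultiplicity S m → IsFrobenius S f → ¬ Special S m f →
    IsMaxSGminusF S f h →
    IsMinimalGenerator (λ n → n ∈A[ S , h , m ]) (2 * m)
      × IsMinimalGenerator (λ n → n ∈A[ S , h , m ]) h
proposition4p7 S m f h isMult@(m∈S , m≢0 , _) _ nonSpecial isMax@((hSG , _) , _) =
    ((inj₁ 2m∈S , >⇒≢ m<2m) , >⇒≢ 0<2m
    , double-not-SumOfTwoNonzero (∈A⇒multiplicity< S isMult m<h))
  , ((inj₂ refl , >⇒≢ m<h) , >⇒≢ (≤-<-trans z≤n m<h)
    , gap-not-SumOfTwoNonzero S (∈A∧<⇒∈S S) (proj₁ hSG))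
  where
  m<h : m < h
  m<h = multiplicity<maxSGminusF {S} {m} {f} nonSpecial isMax

  2m∈S : _∈S S (2 * m)
  2m∈S = subst (_∈S S) (n+n≡2*n m) (+-closed S m∈S m∈S)

  m<2m : m < 2 * m
  m<2m = subst (m <_) (n+n≡2*n m) (m<m+n m (n≢0⇒n>0 m≢0))

  0<2m : 0 < 2 * m
  0<2m = ≤-<-trans z≤n m<2m
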